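{- For $d\ge1$ and positive integers $l_1,\dots,l_d$, \[ \sum_{i=0}^{d-1}x_{l_{i+1}}\cdots x_{l_d}x_{l_1}\cdots x_{l_i}\equiv\begin{cases}x_{l_1+\cdots+l_d}& d\text{ odd}\\0& d\text{ even}\end{cases}\pmod{\mathfrak X^+\diamond\mathfrak X^+}. \]
   Context: $\mathfrak X=\mathbb Q\langle x_1,x_2,\dots\rangle$ is the free non-commutative $\mathbb Q$-algebra, $\mathfrak X^+$ the span of all non-empty monomials $x_{k_1}\cdots x_{k_d}$ ($d\ge1$). For $k\ge0$, $s_k:\mathfrak X\to\mathfrak X$ is linear with $s_k(x_iw)=x_{i+k}w$, $s_k(1)=0$. The block shuffle product $\diamond$ is the bilinear map $\mathfrak X\times\mathfrak X\to\mathfrak X$ with $u\diamond1=1\diamond u=u$ and $x_au\diamond x_bv=x_a(u\diamond x_bv)+x_b(x_au\diamond v)-s_{a+b}(u\diamond v)$. $\mathfrak X^+\diamond\mathfrak X^+$ denotes the $\mathbb Q$-subspace spanned by $\{u\diamond v: u,v\in\mathfrak X^+\}$. -}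

module Defs where

open import Data.Nat using (ℕ; zero; suc; _+_; pred; NonZero; _%_; _≡ᵇ_)
open import Data.Nat.Properties using () renaming (_≟_ to _≟ℕ_)
open import Data.List using (List; []; _∷_; _++_; map; length; take; drop; upTo; foldr; concatMap)
open import Data.Nat.ListAction using (sum)
open import Data.List.Properties using (≡-dec)
open import Data.List.Relation.Unary.All using (All)
open import Data.Rational using (ℚ; 0ℚ; 1ℚ; _*_; -_) renaming (_+_ to _+ℚ_)
open import Data.Product using (_×_; _,_; Σ)
open import Data.Bool using (if_then_else_)
open import Relation.Binary.PropositionalEquality using (_≡_)
open import Relation.Nullary using (yes; no)

-- Letters: the natural number n encodes the generator x_{1+n}
-- (so the generators are exactly x_1, x_2, ...).
Letter : Set
Letter = ℕ

Word : Set
Word = List Letter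

-- Elements of 𝔛 = ℚ⟨x_1,x_2,...⟩ as finite formal linear combinations
-- of words; equality of elements is coefficientwise (see _≈_ below).
Poly : Set
Poly = List (ℚ × Word)

coeff : Poly → Word → ℚ
coeff [] w = 0ℚ
coeff ((c , v) ∷ p) w with ≡-dec _≟ℕ_ v w
... | yes _ = c +ℚ coeff p w
... | no  _ = coeff p w

infix 4 _≈_
_≈_ : Poly → Poly → Set
p ≈ q = ∀ w → coeff p w ≡ coeff q w

_⊕_ : Poly → Poly → Poly
p ⊕ q = p ++ q

scale : ℚ → Poly → Poly
scale c p = map (λ { (a , w) → (c * a , w) }) p

_⊖_ : Poly → Poly → Poly
p ⊖ q = p ⊕ scale (- 1ℚ) q

lmul : Letter → Poly → Poly
lmul a p = map (λ { (c , w) → (c , a ∷ w) }) p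

sWord : ℕ → Word → Poly
sWord k [] = []
sWord k (a ∷ w) = (1ℚ , (a + k) ∷ w) ∷ []

s : ℕ → Poly → Poly
s k p = concatMap (λ { (c , w) → scale c (sWord k w) }) p

-- block shuffle product on words.  Encoded letters a, b stand for
-- x_{1+a}, x_{1+b}, so the shift s_{A+B} with A = 1+a, B = 1+b is
-- s (suc a + suc b).
◇w : Word → Word → Poly
◇w [] v = (1ℚ , v) ∷ []
◇w (a ∷ u) [] = (1ℚ , a ∷ u) ∷ []
◇w (a ∷ u) (b ∷ v) =
  (lmul a (◇w u (b ∷ v)) ⊕ lmul b (◇w (a ∷ u) v))
  ⊖ s (suc a + suc b) (◇w u v)

_◇_ : Poly → Poly → Poly
p ◇ q = concatMap (λ { (c , u) → concatMap (λ { (d , v) → scale (c * d) (◇w u v) }) q }) p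

-- membership in 𝔛⁺ (span of non-empty monomials): coefficient of 1 vanishes
InX⁺ : Poly → Set
InX⁺ p = coeff p [] ≡ 0ℚ

record Gen : Set where
  constructor gen
  field
    c  : ℚ
    u  : Poly
    v  : Poly
    u⁺ : InX⁺ u
    v⁺ : InX⁺ v

genVal : Gen → Poly
genVal g = scale (Gen.c g) (Gen.u g ◇ Gen.v g)

InShuffleSpan : Poly → Set
InShuffleSpan p = Σ (List Gen) λ gs → p ≈ concatMap genVal gs

_≡_mod◇ : Poly → Poly → Set
p ≡ q mod◇ = InShuffleSpan (p ⊖ q)

wordOf : List ℕ → Word
wordOf ls = map pred ls

cyclicSum : List ℕ → Poly
cyclicSum ls = map (λ i → (1ℚ , drop i w ++ take i w)) (upTo (length ls))
  where w = wordOf ls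

cyclicRHS : List ℕ → Poly
cyclicRHS ls = if (length ls % 2) ≡ᵇ 1 then (1ℚ , pred (sum ls) ∷ []) ∷ [] else []

-- Split u ◇ v = u ◇ˡ v + u ◇ʳ v according to whether the first block of a
-- term ends with a letter of u or of v.  Since (a u) ◇ʳ (b v) = (b a u) ◇ˡ v,
-- modulo 𝔛⁺ ◇ 𝔛⁺ a letter may be moved from the right argument of ◇ˡ to the
-- front of the left one at the cost of a sign.  Writing the rotation
-- x_{l_{i+1}} ⋯ x_{l_d} x_{l_1} ⋯ x_{l_i} as x_{l_{i+1}} ◇ˡ (x_{l_{i+2}} ⋯ x_{l_i})
-- and moving x_{l_{i+2}}, …, x_{l_d} across turns the cyclic sum into the
-- alternating sum of (x_{l_d} ⋯ x_{l_{i+1}}) ◇ˡ (x_{l_1} ⋯ x_{l_i}).  Expanding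
-- ◇ and ◇ˡ by their recursions, the analogous alternating sum of ◇-products
-- vanishes by induction on d, and the one of ◇ˡ-products reduces to
-- s_{l_1 + l_d} of the same sum for l_2, …, l_{d-1}; this leaves x_{l_1+⋯+l_d}
-- when d is odd and 0 when d is even.

module Submission where

open import Defs
open import Data.Bool using (Bool; true; false; if_then_else_)
open import Data.List using (List; []; _∷_; _++_; _ʳ++_; map; length; reverse; drop; take; applyUpTo; concatMap)
open import Data.List.Properties using (≡-dec; ++-identityʳ; ++-assoc; map-++; concatMap-++; ∷-injectiveˡ; ∷-injectiveʳ; reverse-++; length-++; length-ʳ++; length-map; map-upTo)
open import Data.List.Relation.Unary.All using (All; []; _∷_)
open import Data.Nat using (ℕ; zero; suc; pred; NonZero; _≥_; _+_; _≤_; _<_; _∸_; _%_; _≡ᵇ_)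
open import Data.Nat.Properties using (_≤?_; ≰⇒>; m∸n+n≡m; +-suc; +-comm; +-assoc; +-identityʳ; +-cancelʳ-≡; +-cancelʳ-<; m≤n+m; <⇒≱; suc-pred) renaming (_≟_ to _≟ℕ_)
open import Data.Nat.ListAction using (sum)
open import Data.Nat.ListAction.Properties using (sum-++)
open import Data.Nat.Tactic.RingSolver using (solve-∀)
open import Data.Product using (_×_; _,_)
open import Data.Rational using (ℚ; 0ℚ; 1ℚ; -_) renaming (_+_ to _+q_; _*_ to _*q_)
import Data.Rational.Properties as ℚ
open import Data.Rational.Solver using (module +-*-Solver)
open +-*-Solver using (solve; _:=_; _:+_; _:*_; con)
open import Level using (0ℓ)
open import Relation.Binary.Bundles using (Setoid)
import Relation.Binary.Reasoning.Setoid as SetoidReasoning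
open import Relation.Binary.PropositionalEquality using (_≡_; refl; sym; trans; cong; cong₂; subst; _≗_; module ≡-Reasoning)
open import Relation.Nullary using (yes; no; ¬_; contradiction)

neg : Poly → Poly
neg = scale (- 1ℚ)

mono : Word → Poly
mono u = (1ℚ , u) ∷ []

x[_] : Letter → Poly
x[ a ] = mono (a ∷ [])

coeffTerm : ℚ → Word → Word → ℚ
coeffTerm c v w with ≡-dec _≟ℕ_ v w
... | yes _ = c
... | no  _ = 0ℚ

coeff-∷ : ∀ c v p w → coeff ((c , v) ∷ p) w ≡ coeffTerm c v w +q coeff p w
coeff-∷ c v p w with ≡-dec _≟ℕ_ v w
... | yes _ = refl
... | no  _ = sym (ℚ.+-identityˡ (coeff p w))

coeffTerm-≢ : ∀ c {v w} → ¬ v ≡ w → coeffTerm c v w ≡ 0ℚ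
coeffTerm-≢ c {v} {w} v≢w with ≡-dec _≟ℕ_ v w
... | yes v≡w = contradiction v≡w v≢w
... | no  _   = refl

coeffTerm-⇔ : ∀ c {v w v′ w′} → (v ≡ w → v′ ≡ w′) → (v′ ≡ w′ → v ≡ w) →
              coeffTerm c v w ≡ coeffTerm c v′ w′
coeffTerm-⇔ c {v} {w} {v′} {w′} to from with ≡-dec _≟ℕ_ v w | ≡-dec _≟ℕ_ v′ w′
... | yes _   | yes _    = refl
... | yes v≡w | no v′≢w′ = contradiction (to v≡w) v′≢w′
... | no v≢w  | yes v′≡w′ = contradiction (from v′≡w′) v≢w
... | no _    | no _     = refl

coeff-⊕ : ∀ p q w → coeff (p ⊕ q) w ≡ coeff p w +q coeff q w
coeff-⊕ [] q w = sym (ℚ.+-identityˡ (coeff q w))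
coeff-⊕ ((c , v) ∷ p) q w = begin
  coeff ((c , v) ∷ (p ++ q)) w                   ≡⟨ coeff-∷ c v (p ++ q) w ⟩
  coeffTerm c v w +q coeff (p ++ q) w            ≡⟨ cong (coeffTerm c v w +q_) (coeff-⊕ p q w) ⟩
  coeffTerm c v w +q (coeff p w +q coeff q w)    ≡⟨ ℚ.+-assoc (coeffTerm c v w) (coeff p w) (coeff q w) ⟨
  (coeffTerm c v w +q coeff p w) +q coeff q w    ≡⟨ cong (_+q coeff q w) (coeff-∷ c v p w) ⟨
  coeff ((c , v) ∷ p) w +q coeff q w             ∎
  where open ≡-Reasoning

coeff-scale : ∀ a p w → coeff (scale a p) w ≡ a *q coeff p w
coeff-scale a [] w = sym (ℚ.*-zeroʳ a)
coeff-scale a ((c , v) ∷ p) w = begin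
  coeff ((a *q c , v) ∷ scale a p) w               ≡⟨ coeff-∷ (a *q c) v (scale a p) w ⟩
  coeffTerm (a *q c) v w +q coeff (scale a p) w    ≡⟨ cong₂ _+q_ (term v w) (coeff-scale a p w) ⟩
  a *q coeffTerm c v w +q a *q coeff p w           ≡⟨ ℚ.*-distribˡ-+ a (coeffTerm c v w) (coeff p w) ⟨
  a *q (coeffTerm c v w +q coeff p w)              ≡⟨ cong (a *q_) (coeff-∷ c v p w) ⟨
  a *q coeff ((c , v) ∷ p) w                       ∎
  where
  open ≡-Reasoning
  term : ∀ v w → coeffTerm (a *q c) v w ≡ a *q coeffTerm c v w
  term v w with ≡-dec _≟ℕ_ v w
  ... | yes _ = refl
  ... | no  _ = sym (ℚ.*-zeroʳ a)

coeff-⊖ : ∀ p q w → coeff (p ⊖ q) w ≡ coeff p w +q (- 1ℚ) *q coeff q w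
coeff-⊖ p q w = trans (coeff-⊕ p (neg q) w) (cong (coeff p w +q_) (coeff-scale (- 1ℚ) q w))

-- _≈_ as a record, so that Agda can infer both sides from a proof.
infix 4 _≃_
record _≃_ (p q : Poly) : Set where
  constructor coeffwise
  field at : p ≈ q
open _≃_

≃-refl : ∀ {p} → p ≃ p
≃-refl = coeffwise λ _ → refl

≃-sym : ∀ {p q} → p ≃ q → q ≃ p
≃-sym (coeffwise e) = coeffwise λ w → sym (e w)

≃-trans : ∀ {p q r} → p ≃ q → q ≃ r → p ≃ r
≃-trans (coeffwise e) (coeffwise f) = coeffwise λ w → trans (e w) (f w)

≡⇒≃ : ∀ {p q} → p ≡ q → p ≃ q
≡⇒≃ refl = ≃-refl

≃-setoid : Setoid 0ℓ 0ℓ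
≃-setoid = record
  { Carrier = Poly ; _≈_ = _≃_
  ; isEquivalence = record { refl = ≃-refl ; sym = ≃-sym ; trans = ≃-trans } }

module ≃-Reasoning = SetoidReasoning ≃-setoid

⊕-cong : ∀ {p p′ q q′} → p ≃ p′ → q ≃ q′ → p ⊕ q ≃ p′ ⊕ q′
⊕-cong {p} {p′} {q} {q′} (coeffwise e) (coeffwise f) = coeffwise λ w →
  trans (coeff-⊕ p q w) (trans (cong₂ _+q_ (e w) (f w)) (sym (coeff-⊕ p′ q′ w)))

scale-cong : ∀ a {p q} → p ≃ q → scale a p ≃ scale a q
scale-cong a {p} {q} (coeffwise e) = coeffwise λ w →
  trans (coeff-scale a p w) (trans (cong (a *q_) (e w)) (sym (coeff-scale a q w)))

neg-cong : ∀ {p q} → p ≃ q → neg p ≃ neg q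
neg-cong = scale-cong (- 1ℚ)

⊖-cong : ∀ {p p′ q q′} → p ≃ p′ → q ≃ q′ → p ⊖ q ≃ p′ ⊖ q′
⊖-cong e f = ⊕-cong e (neg-cong f)

neg-involutive : ∀ p → neg (neg p) ≃ p
neg-involutive p = coeffwise λ w →
  trans (coeff-scale (- 1ℚ) (neg p) w) (trans (cong ((- 1ℚ) *q_) (coeff-scale (- 1ℚ) p w))
    (solve 1 (λ x → con (- 1ℚ) :* (con (- 1ℚ) :* x) := x) refl (coeff p w)))

⊖-self : ∀ p → p ⊖ p ≃ []
⊖-self p = coeffwise λ w → trans (coeff-⊖ p p w)
  (solve 1 (λ x → x :+ con (- 1ℚ) :* x := con 0ℚ) refl (coeff p w))

neg-⊖-flip : ∀ p q → neg (p ⊖ q) ≃ q ⊖ p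
neg-⊖-flip p q = coeffwise λ w →
  trans (coeff-scale (- 1ℚ) (p ⊖ q) w) (trans (cong ((- 1ℚ) *q_) (coeff-⊖ p q w))
    (trans (solve 2 (λ x y → con (- 1ℚ) :* (x :+ con (- 1ℚ) :* y) := y :+ con (- 1ℚ) :* x)
             refl (coeff p w) (coeff q w))
      (sym (coeff-⊖ q p w))))

neg-⊖-distrib : ∀ p q → neg (p ⊖ q) ≃ neg p ⊖ neg q
neg-⊖-distrib p q = coeffwise λ w →
  trans (coeff-scale (- 1ℚ) (p ⊖ q) w) (trans (cong ((- 1ℚ) *q_) (coeff-⊖ p q w))
    (trans (solve 2 (λ x y → con (- 1ℚ) :* (x :+ con (- 1ℚ) :* y)
                           := con (- 1ℚ) :* x :+ con (- 1ℚ) :* (con (- 1ℚ) :* y))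
             refl (coeff p w) (coeff q w))
      (sym (trans (coeff-⊖ (neg p) (neg q) w)
        (cong₂ (λ x y → x +q (- 1ℚ) *q y) (coeff-scale (- 1ℚ) p w) (coeff-scale (- 1ℚ) q w))))))

⊖-telescope : ∀ p q r → (p ⊖ q) ⊕ (q ⊖ r) ≃ p ⊖ r
⊖-telescope p q r = coeffwise λ w →
  trans (coeff-⊕ (p ⊖ q) (q ⊖ r) w) (trans (cong₂ _+q_ (coeff-⊖ p q w) (coeff-⊖ q r w))
    (trans (solve 3 (λ x y z → (x :+ con (- 1ℚ) :* y) :+ (y :+ con (- 1ℚ) :* z) := x :+ con (- 1ℚ) :* z)
             refl (coeff p w) (coeff q w) (coeff r w))
      (sym (coeff-⊖ p r w))))

⊖-⊕-interchange : ∀ p q p′ q′ → (p ⊕ q) ⊖ (p′ ⊕ q′) ≃ (p ⊖ p′) ⊕ (q ⊖ q′)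
⊖-⊕-interchange p q p′ q′ = coeffwise λ w →
  trans (coeff-⊖ (p ⊕ q) (p′ ⊕ q′) w)
    (trans (cong₂ (λ x y → x +q (- 1ℚ) *q y) (coeff-⊕ p q w) (coeff-⊕ p′ q′ w))
      (trans (solve 4 (λ a b c d → (a :+ b) :+ con (- 1ℚ) :* (c :+ d)
                                 := (a :+ con (- 1ℚ) :* c) :+ (b :+ con (- 1ℚ) :* d))
               refl (coeff p w) (coeff q w) (coeff p′ w) (coeff q′ w))
        (sym (trans (coeff-⊕ (p ⊖ p′) (q ⊖ q′) w) (cong₂ _+q_ (coeff-⊖ p p′ w) (coeff-⊖ q q′ w))))))

⊖-⊖-interchange : ∀ p q p′ q′ → (p ⊖ q) ⊖ (p′ ⊖ q′) ≃ (p ⊖ p′) ⊖ (q ⊖ q′)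
⊖-⊖-interchange p q p′ q′ = coeffwise λ w →
  trans (coeff-⊖ (p ⊖ q) (p′ ⊖ q′) w)
    (trans (cong₂ (λ x y → x +q (- 1ℚ) *q y) (coeff-⊖ p q w) (coeff-⊖ p′ q′ w))
      (trans (solve 4 (λ a b c d → (a :+ con (- 1ℚ) :* b) :+ con (- 1ℚ) :* (c :+ con (- 1ℚ) :* d)
                                 := (a :+ con (- 1ℚ) :* c) :+ con (- 1ℚ) :* (b :+ con (- 1ℚ) :* d))
               refl (coeff p w) (coeff q w) (coeff p′ w) (coeff q′ w))
        (sym (trans (coeff-⊖ (p ⊖ p′) (q ⊖ q′) w)
          (cong₂ (λ x y → x +q (- 1ℚ) *q y) (coeff-⊖ p p′ w) (coeff-⊖ q q′ w))))))

⊕≃⊖-neg : ∀ p q → p ⊕ q ≃ p ⊖ neg q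
⊕≃⊖-neg p q = ⊕-cong ≃-refl (≃-sym (neg-involutive q))

neg^ : ℕ → Poly → Poly
neg^ zero p = p
neg^ (suc n) p = neg (neg^ n p)

neg^-cong : ∀ n {p q} → p ≃ q → neg^ n p ≃ neg^ n q
neg^-cong zero e = e
neg^-cong (suc n) e = neg-cong (neg^-cong n e)

neg^-⊖ : ∀ n p q → neg^ n (p ⊖ q) ≡ neg^ n p ⊕ neg^ (suc n) q
neg^-⊖ zero p q = refl
neg^-⊖ (suc n) p q = trans (cong neg (neg^-⊖ n p q)) (map-++ _ (neg^ n p) (neg^ (suc n) q))

coeff-lmul-[] : ∀ a p → coeff (lmul a p) [] ≡ 0ℚ
coeff-lmul-[] a [] = refl
coeff-lmul-[] a (_ ∷ p) = coeff-lmul-[] a p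

coeff-lmul-∷ : ∀ a p w → coeff (lmul a p) (a ∷ w) ≡ coeff p w
coeff-lmul-∷ a [] w = refl
coeff-lmul-∷ a ((c , v) ∷ p) w = begin
  coeff ((c , a ∷ v) ∷ lmul a p) (a ∷ w)              ≡⟨ coeff-∷ c (a ∷ v) (lmul a p) (a ∷ w) ⟩
  coeffTerm c (a ∷ v) (a ∷ w) +q coeff (lmul a p) (a ∷ w) ≡⟨ cong₂ _+q_ (coeffTerm-⇔ c ∷-injectiveʳ (cong (a ∷_))) (coeff-lmul-∷ a p w) ⟩
  coeffTerm c v w +q coeff p w                         ≡⟨ coeff-∷ c v p w ⟨
  coeff ((c , v) ∷ p) w                                ∎
  where open ≡-Reasoning

coeff-lmul-≢ : ∀ a b p w → ¬ a ≡ b → coeff (lmul a p) (b ∷ w) ≡ 0ℚ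
coeff-lmul-≢ a b [] w a≢b = refl
coeff-lmul-≢ a b ((c , v) ∷ p) w a≢b =
  trans (coeff-∷ c (a ∷ v) (lmul a p) (b ∷ w))
    (trans (cong₂ _+q_ (coeffTerm-≢ c (λ e → a≢b (∷-injectiveˡ e))) (coeff-lmul-≢ a b p w a≢b))
           (ℚ.+-identityˡ 0ℚ))

lmul-cong : ∀ a {p q} → p ≃ q → lmul a p ≃ lmul a q
lmul-cong a {p} {q} (coeffwise e) = coeffwise at-word
  where
  at-word : lmul a p ≈ lmul a q
  at-word [] = trans (coeff-lmul-[] a p) (sym (coeff-lmul-[] a q))
  at-word (b ∷ w) with a ≟ℕ b
  ... | yes refl = trans (coeff-lmul-∷ a p w) (trans (e w) (sym (coeff-lmul-∷ a q w)))
  ... | no a≢b  = trans (coeff-lmul-≢ a b p w a≢b) (sym (coeff-lmul-≢ a b q w a≢b))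

lmul-⊖ : ∀ a p q → lmul a (p ⊖ q) ≡ lmul a p ⊖ lmul a q
lmul-⊖ a p q = trans (map-++ _ p (neg q)) (cong (lmul a p ⊕_) (lmul-neg q))
  where
  lmul-neg : ∀ q → lmul a (neg q) ≡ neg (lmul a q)
  lmul-neg [] = refl
  lmul-neg ((d , v) ∷ q) = cong ((- 1ℚ *q d , a ∷ v) ∷_) (lmul-neg q)

lmul-◇w-[] : ∀ a u → lmul a (◇w u []) ≡ mono (a ∷ u)
lmul-◇w-[] a [] = refl
lmul-◇w-[] a (_ ∷ _) = refl

+-≢-< : ∀ {a k b} → b < k → ¬ a + k ≡ b
+-≢-< {a} {k} b<k a+k≡b = <⇒≱ b<k (subst (k ≤_) a+k≡b (m≤n+m k a))

coeff-s-[] : ∀ k p → coeff (s k p) [] ≡ 0ℚ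
coeff-s-[] k [] = refl
coeff-s-[] k ((c , []) ∷ p) = coeff-s-[] k p
coeff-s-[] k ((c , _ ∷ _) ∷ p) = coeff-s-[] k p

coeff-s-+ : ∀ k p a w → coeff (s k p) ((a + k) ∷ w) ≡ coeff p (a ∷ w)
coeff-s-+ k [] a w = refl
coeff-s-+ k ((c , []) ∷ p) a w = coeff-s-+ k p a w
coeff-s-+ k ((c , b ∷ v) ∷ p) a w = begin
  coeff ((c *q 1ℚ , (b + k) ∷ v) ∷ s k p) ((a + k) ∷ w)
    ≡⟨ coeff-∷ (c *q 1ℚ) ((b + k) ∷ v) (s k p) ((a + k) ∷ w) ⟩
  coeffTerm (c *q 1ℚ) ((b + k) ∷ v) ((a + k) ∷ w) +q coeff (s k p) ((a + k) ∷ w)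
    ≡⟨ cong₂ _+q_ (coeffTerm-⇔ (c *q 1ℚ) unshift (λ e → cong₂ _∷_ (cong (_+ k) (∷-injectiveˡ e)) (∷-injectiveʳ e))) (coeff-s-+ k p a w) ⟩
  coeffTerm (c *q 1ℚ) (b ∷ v) (a ∷ w) +q coeff p (a ∷ w)
    ≡⟨ cong (λ x → coeffTerm x (b ∷ v) (a ∷ w) +q coeff p (a ∷ w)) (ℚ.*-identityʳ c) ⟩
  coeffTerm c (b ∷ v) (a ∷ w) +q coeff p (a ∷ w)
    ≡⟨ coeff-∷ c (b ∷ v) p (a ∷ w) ⟨
  coeff ((c , b ∷ v) ∷ p) (a ∷ w) ∎
  where
  open ≡-Reasoning
  unshift : (b + k) ∷ v ≡ (a + k) ∷ w → b ∷ v ≡ a ∷ w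
  unshift e = cong₂ _∷_ (+-cancelʳ-≡ k b a (∷-injectiveˡ e)) (∷-injectiveʳ e)

coeff-s-< : ∀ k p b w → b < k → coeff (s k p) (b ∷ w) ≡ 0ℚ
coeff-s-< k [] b w b<k = refl
coeff-s-< k ((c , []) ∷ p) b w b<k = coeff-s-< k p b w b<k
coeff-s-< k ((c , a ∷ v) ∷ p) b w b<k =
  trans (coeff-∷ (c *q 1ℚ) ((a + k) ∷ v) (s k p) (b ∷ w))
    (trans (cong₂ _+q_ (coeffTerm-≢ (c *q 1ℚ) {(a + k) ∷ v} {b ∷ w} (λ e → +-≢-< b<k (∷-injectiveˡ e))) (coeff-s-< k p b w b<k))
           (ℚ.+-identityˡ 0ℚ))

s-unique : ∀ k p q → coeff q [] ≡ 0ℚ →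
           (∀ a w → coeff q ((a + k) ∷ w) ≡ coeff p (a ∷ w)) →
           (∀ b w → b < k → coeff q (b ∷ w) ≡ 0ℚ) → s k p ≃ q
s-unique k p q q₀ q-shift q-low = coeffwise at-word
  where
  at-word : s k p ≈ q
  at-word [] = trans (coeff-s-[] k p) (sym q₀)
  at-word (b ∷ w) with k ≤? b
  ... | yes k≤b = subst (λ x → coeff (s k p) (x ∷ w) ≡ coeff q (x ∷ w)) (m∸n+n≡m k≤b)
                    (trans (coeff-s-+ k p (b ∸ k) w) (sym (q-shift (b ∸ k) w)))
  ... | no k≰b  = trans (coeff-s-< k p b w (≰⇒> k≰b)) (sym (q-low b w (≰⇒> k≰b)))

s-cong : ∀ k {p q} → p ≃ q → s k p ≃ s k q
s-cong k {p} {q} (coeffwise e) =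
  s-unique k p (s k q) (coeff-s-[] k q) (λ a w → trans (coeff-s-+ k q a w) (sym (e (a ∷ w)))) (coeff-s-< k q)

s-⊕ : ∀ k p q → s k (p ⊕ q) ≡ s k p ⊕ s k q
s-⊕ k p q = concatMap-++ _ p q

s-neg : ∀ k p → s k (neg p) ≃ neg (s k p)
s-neg k p = s-unique k (neg p) (neg (s k p))
  (trans (coeff-scale (- 1ℚ) (s k p) []) (trans (cong ((- 1ℚ) *q_) (coeff-s-[] k p)) (ℚ.*-zeroʳ (- 1ℚ))))
  (λ a w → trans (coeff-scale (- 1ℚ) (s k p) ((a + k) ∷ w))
             (trans (cong ((- 1ℚ) *q_) (coeff-s-+ k p a w)) (sym (coeff-scale (- 1ℚ) p (a ∷ w)))))
  (λ b w b<k → trans (coeff-scale (- 1ℚ) (s k p) (b ∷ w))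
                 (trans (cong ((- 1ℚ) *q_) (coeff-s-< k p b w b<k)) (ℚ.*-zeroʳ (- 1ℚ))))

s-⊖ : ∀ k p q → s k (p ⊖ q) ≃ s k p ⊖ s k q
s-⊖ k p q = ≃-trans (≡⇒≃ (s-⊕ k p (neg q))) (⊕-cong ≃-refl (s-neg k q))

s-∘-s : ∀ k m p → s k (s m p) ≃ s (m + k) p
s-∘-s k m p = ≃-sym (s-unique (m + k) p (s k (s m p)) (coeff-s-[] k (s m p)) shifted low)
  where
  shifted : ∀ a w → coeff (s k (s m p)) ((a + (m + k)) ∷ w) ≡ coeff p (a ∷ w)
  shifted a w = trans (cong (λ x → coeff (s k (s m p)) (x ∷ w)) (sym (+-assoc a m k)))
                  (trans (coeff-s-+ k (s m p) (a + m) w) (coeff-s-+ m p a w))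
  low : ∀ b w → b < m + k → coeff (s k (s m p)) (b ∷ w) ≡ 0ℚ
  low b w b<m+k with k ≤? b
  ... | no k≰b  = coeff-s-< k (s m p) b w (≰⇒> k≰b)
  ... | yes k≤b = subst (λ x → coeff (s k (s m p)) (x ∷ w) ≡ 0ℚ) (m∸n+n≡m k≤b)
        (trans (coeff-s-+ k (s m p) (b ∸ k) w)
          (coeff-s-< m p (b ∸ k) w (+-cancelʳ-< k (b ∸ k) m (subst (_< m + k) (sym (m∸n+n≡m k≤b)) b<m+k))))

s-lmul : ∀ k a p → s k (lmul a p) ≃ lmul (a + k) p
s-lmul k a p = s-unique k (lmul a p) (lmul (a + k) p) (coeff-lmul-[] (a + k) p) shifted low
  where
  shifted : ∀ b w → coeff (lmul (a + k) p) ((b + k) ∷ w) ≡ coeff (lmul a p) (b ∷ w)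
  shifted b w with a ≟ℕ b
  ... | yes refl = trans (coeff-lmul-∷ (a + k) p w) (sym (coeff-lmul-∷ a p w))
  ... | no a≢b  = trans (coeff-lmul-≢ (a + k) (b + k) p w (λ e → a≢b (+-cancelʳ-≡ k a b e)))
                        (sym (coeff-lmul-≢ a b p w a≢b))
  low : ∀ b w → b < k → coeff (lmul (a + k) p) (b ∷ w) ≡ 0ℚ
  low b w b<k = coeff-lmul-≢ (a + k) b p w (+-≢-< b<k)

span-≃ : ∀ {p q} → p ≃ q → InShuffleSpan p → InShuffleSpan q
span-≃ (coeffwise e) (gs , f) = gs , λ w → trans (sym (e w)) (f w)

span-[] : InShuffleSpan []
span-[] = [] , λ _ → refl

span-⊕ : ∀ p q → InShuffleSpan p → InShuffleSpan q → InShuffleSpan (p ⊕ q)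
span-⊕ p q (gs , e) (hs , f) = gs ++ hs , λ w →
  trans (at (⊕-cong {p} {concatMap genVal gs} {q} {concatMap genVal hs} (coeffwise e) (coeffwise f)) w)
        (cong (λ x → coeff x w) (sym (concatMap-++ genVal gs hs)))

span-scale : ∀ a p → InShuffleSpan p → InShuffleSpan (scale a p)
span-scale a p (gs , e) = map scaleGen gs , at (≃-trans (scale-cong a {p} {concatMap genVal gs} (coeffwise e)) (scale-gens gs))
  where
  scaleGen : Gen → Gen
  scaleGen (gen c u v u⁺ v⁺) = gen (a *q c) u v u⁺ v⁺
  scale-scale : ∀ c q → scale a (scale c q) ≃ scale (a *q c) q
  scale-scale c q = coeffwise λ w →
    trans (coeff-scale a (scale c q) w) (trans (cong (a *q_) (coeff-scale c q w))
      (trans (sym (ℚ.*-assoc a c (coeff q w))) (sym (coeff-scale (a *q c) q w))))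
  scale-gens : ∀ gs → scale a (concatMap genVal gs) ≃ concatMap genVal (map scaleGen gs)
  scale-gens [] = ≃-refl
  scale-gens (gen c u v u⁺ v⁺ ∷ gs) =
    ≃-trans (≡⇒≃ (map-++ _ (genVal (gen c u v u⁺ v⁺)) (concatMap genVal gs)))
            (⊕-cong (scale-scale c (u ◇ v)) (scale-gens gs))

span-◇w : ∀ a u b v → InShuffleSpan (◇w (a ∷ u) (b ∷ v))
span-◇w a u b v = gen 1ℚ (mono (a ∷ u)) (mono (b ∷ v)) refl refl ∷ [] , λ w →
  let X = ◇w (a ∷ u) (b ∷ v) in
  sym (begin
    coeff (scale 1ℚ ((scale 1ℚ X ++ []) ++ []) ++ []) w
      ≡⟨ cong (λ p → coeff p w) (trans (++-identityʳ (scale 1ℚ ((scale 1ℚ X ++ []) ++ [])))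
           (cong (scale 1ℚ) (trans (++-identityʳ (scale 1ℚ X ++ [])) (++-identityʳ (scale 1ℚ X))))) ⟩
    coeff (scale 1ℚ (scale 1ℚ X)) w
      ≡⟨ trans (coeff-scale 1ℚ (scale 1ℚ X) w) (ℚ.*-identityˡ _) ⟩
    coeff (scale 1ℚ X) w
      ≡⟨ trans (coeff-scale 1ℚ X w) (ℚ.*-identityˡ _) ⟩
    coeff X w ∎)
  where open ≡-Reasoning

-- _≡_mod◇ as a record, for the same reason.
infix 4 _∼_
record _∼_ (p q : Poly) : Set where
  constructor inSpan
  field proof : p ≡ q mod◇

≃⇒∼ : ∀ {p q} → p ≃ q → p ∼ q
≃⇒∼ {p} {q} e = inSpan (span-≃ (≃-sym (≃-trans (⊖-cong e ≃-refl) (⊖-self q))) span-[])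

∼-refl : ∀ {p} → p ∼ p
∼-refl = ≃⇒∼ ≃-refl

∼-sym : ∀ {p q} → p ∼ q → q ∼ p
∼-sym {p} {q} (inSpan h) = inSpan (span-≃ (neg-⊖-flip p q) (span-scale (- 1ℚ) (p ⊖ q) h))

∼-trans : ∀ {p q r} → p ∼ q → q ∼ r → p ∼ r
∼-trans {p} {q} {r} (inSpan h) (inSpan k) = inSpan (span-≃ (⊖-telescope p q r) (span-⊕ (p ⊖ q) (q ⊖ r) h k))

∼-⊕ : ∀ {p p′ q q′} → p ∼ p′ → q ∼ q′ → p ⊕ q ∼ p′ ⊕ q′
∼-⊕ {p} {p′} {q} {q′} (inSpan h) (inSpan k) =
  inSpan (span-≃ (≃-sym (⊖-⊕-interchange p q p′ q′)) (span-⊕ (p ⊖ p′) (q ⊖ q′) h k))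

∼-neg : ∀ {p q} → p ∼ q → neg p ∼ neg q
∼-neg {p} {q} (inSpan h) = inSpan (span-≃ (neg-⊖-distrib p q) (span-scale (- 1ℚ) (p ⊖ q) h))

∼-setoid : Setoid 0ℓ 0ℓ
∼-setoid = record
  { Carrier = Poly ; _≈_ = _∼_
  ; isEquivalence = record { refl = ∼-refl ; sym = ∼-sym ; trans = ∼-trans } }

module ∼-Reasoning = SetoidReasoning ∼-setoid

-- The two halves of the block shuffle product

_◇ˡ_ _◇ʳ_ : Word → Word → Poly
[] ◇ˡ v = []
(a ∷ u) ◇ˡ [] = mono (a ∷ u)
(a ∷ u) ◇ˡ (b ∷ v) = lmul a (◇w u (b ∷ v)) ⊖ s (suc a + suc b) (u ◇ˡ v)

[] ◇ʳ v = mono v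
(a ∷ u) ◇ʳ [] = []
(a ∷ u) ◇ʳ (b ∷ v) = lmul b (◇w (a ∷ u) v) ⊖ s (suc a + suc b) (u ◇ʳ v)

◇w-split : ∀ u v → ◇w u v ≃ (u ◇ˡ v) ⊕ (u ◇ʳ v)
◇w-split [] v = ≃-refl
◇w-split (a ∷ u) [] = ≡⇒≃ (sym (++-identityʳ _))
◇w-split (a ∷ u) (b ∷ v) =
  ≃-trans (⊖-cong ≃-refl (≃-trans (s-cong k (◇w-split u v)) (≡⇒≃ (s-⊕ k (u ◇ˡ v) (u ◇ʳ v)))))
          (⊖-⊕-interchange (lmul a (◇w u (b ∷ v))) (lmul b (◇w (a ∷ u) v)) (s k (u ◇ˡ v)) (s k (u ◇ʳ v)))
  where k = suc a + suc b

◇ˡ-single : ∀ a v → (a ∷ []) ◇ˡ v ≃ mono (a ∷ v)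
◇ˡ-single a [] = ≃-refl
◇ˡ-single a (b ∷ v) = ≡⇒≃ (++-identityʳ _)

◇ˡ-shift : ∀ k a u v → s k ((a ∷ u) ◇ˡ v) ≃ ((a + k) ∷ u) ◇ˡ v
◇ˡ-shift k a u [] = ≃-refl
◇ˡ-shift k a u (b ∷ v) =
  ≃-trans (s-⊖ k (lmul a (◇w u (b ∷ v))) (s (suc a + suc b) (u ◇ˡ v)))
    (⊖-cong (s-lmul k a (◇w u (b ∷ v)))
            (≃-trans (s-∘-s k (suc a + suc b) (u ◇ˡ v)) (≡⇒≃ (cong (λ m → s m (u ◇ˡ v)) (arith a b k)))))
  where
  arith : ∀ a b k → suc a + suc b + k ≡ suc (a + k) + suc b
  arith = solve-∀

◇ʳ≃◇ˡ : ∀ u b v → u ◇ʳ (b ∷ v) ≃ (b ∷ u) ◇ˡ v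
◇ʳ≃◇ˡ [] b v = ≃-sym (◇ˡ-single b v)
◇ʳ≃◇ˡ (a ∷ []) b [] = ≡⇒≃ (++-identityʳ _)
◇ʳ≃◇ˡ (a ∷ _ ∷ _) b [] = ≡⇒≃ (++-identityʳ _)
◇ʳ≃◇ˡ (a ∷ u) b (c ∷ v) = ⊖-cong ≃-refl (begin
  s (suc a + suc b) (u ◇ʳ (c ∷ v))        ≈⟨ s-cong _ (◇ʳ≃◇ˡ u c v) ⟩
  s (suc a + suc b) ((c ∷ u) ◇ˡ v)        ≈⟨ ◇ˡ-shift _ c u v ⟩
  ((c + (suc a + suc b)) ∷ u) ◇ˡ v        ≡⟨ cong (λ x → (x ∷ u) ◇ˡ v) (arith a b c) ⟩
  ((a + (suc b + suc c)) ∷ u) ◇ˡ v        ≈⟨ ◇ˡ-shift _ a u v ⟨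
  s (suc b + suc c) ((a ∷ u) ◇ˡ v)        ∎)
  where
  open ≃-Reasoning
  arith : ∀ a b c → c + (suc a + suc b) ≡ a + (suc b + suc c)
  arith = solve-∀

◇ˡ-swap : ∀ a u b v → (a ∷ u) ◇ˡ (b ∷ v) ∼ neg ((b ∷ a ∷ u) ◇ˡ v)
◇ˡ-swap a u b v = inSpan (span-≃ split (span-◇w a u b v))
  where
  split : ◇w (a ∷ u) (b ∷ v) ≃ ((a ∷ u) ◇ˡ (b ∷ v)) ⊖ neg ((b ∷ a ∷ u) ◇ˡ v)
  split = ≃-trans (◇w-split (a ∷ u) (b ∷ v))
            (≃-trans (⊕-cong (≃-refl {(a ∷ u) ◇ˡ (b ∷ v)}) (◇ʳ≃◇ˡ (a ∷ u) b v))
                     (⊕≃⊖-neg ((a ∷ u) ◇ˡ (b ∷ v)) ((b ∷ a ∷ u) ◇ˡ v)))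

◇ˡ-transfer : ∀ q₁ a u q₂ → (a ∷ u) ◇ˡ (q₁ ++ q₂) ∼ neg^ (length q₁) ((q₁ ʳ++ a ∷ u) ◇ˡ q₂)
◇ˡ-transfer [] a u q₂ = ∼-refl
◇ˡ-transfer (b ∷ q₁) a u q₂ = ∼-trans (◇ˡ-swap a u b (q₁ ++ q₂)) (∼-neg (◇ˡ-transfer q₁ b (a ∷ u) q₂))

-- Alternating sums along antidiagonals

Grid : Set
Grid = ℕ → ℕ → Poly

Alt : Grid → ℕ → ℕ → Poly
Alt f zero j = f zero j
Alt f (suc i) j = f (suc i) j ⊖ Alt f i (suc j)

_⊕ᴳ_ _⊖ᴳ_ : Grid → Grid → Grid
(f ⊕ᴳ g) a b = f a b ⊕ g a b
(f ⊖ᴳ g) a b = f a b ⊖ g a b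

sᴳ : ℕ → Grid → Grid
sᴳ k f a b = s k (f a b)

lmulˡ lmulʳ : Letter → Grid → Grid
lmulˡ r f zero b = []
lmulˡ r f (suc a) b = lmul r (f a b)
lmulʳ y f a zero = []
lmulʳ y f a (suc b) = lmul y (f a b)

diag : Grid → Grid
diag f (suc a) (suc b) = f a b
diag f _ _ = []

Alt-cong-off-origin : ∀ {f g : Grid} → (∀ a b → f (suc a) b ≃ g (suc a) b) →
  (∀ b → f 0 (suc b) ≃ g 0 (suc b)) → ∀ i j → Alt f (suc i) j ≃ Alt g (suc i) j
Alt-cong-off-origin {f} {g} f≃g f₀≃g₀ i j = ⊖-cong (f≃g i j) (off i j)
  where
  off : ∀ i j → Alt f i (suc j) ≃ Alt g i (suc j)
  off zero j = f₀≃g₀ j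
  off (suc i) j = ⊖-cong (f≃g i (suc j)) (off i (suc j))

Alt-⊕ᴳ : ∀ f g i j → Alt (f ⊕ᴳ g) i j ≃ Alt f i j ⊕ Alt g i j
Alt-⊕ᴳ f g zero j = ≃-refl
Alt-⊕ᴳ f g (suc i) j = ≃-trans (⊖-cong ≃-refl (Alt-⊕ᴳ f g i (suc j)))
  (⊖-⊕-interchange (f (suc i) j) (g (suc i) j) (Alt f i (suc j)) (Alt g i (suc j)))

Alt-⊖ᴳ : ∀ f g i j → Alt (f ⊖ᴳ g) i j ≃ Alt f i j ⊖ Alt g i j
Alt-⊖ᴳ f g zero j = ≃-refl
Alt-⊖ᴳ f g (suc i) j = ≃-trans (⊖-cong ≃-refl (Alt-⊖ᴳ f g i (suc j)))
  (⊖-⊖-interchange (f (suc i) j) (g (suc i) j) (Alt f i (suc j)) (Alt g i (suc j)))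

Alt-sᴳ : ∀ k f i j → Alt (sᴳ k f) i j ≃ s k (Alt f i j)
Alt-sᴳ k f zero j = ≃-refl
Alt-sᴳ k f (suc i) j =
  ≃-trans (⊖-cong ≃-refl (Alt-sᴳ k f i (suc j))) (≃-sym (s-⊖ k (f (suc i) j) (Alt f i (suc j))))

Alt-lmulˡ : ∀ r f i j → Alt (lmulˡ r f) (suc i) j ≃ lmul r (Alt f i j)
Alt-lmulˡ r f zero j = ≡⇒≃ (++-identityʳ _)
Alt-lmulˡ r f (suc i) j = ≃-trans (⊖-cong ≃-refl (Alt-lmulˡ r f i (suc j)))
  (≡⇒≃ (sym (lmul-⊖ r (f (suc i) j) (Alt f i (suc j)))))

Alt-lmulʳ : ∀ y f i j → Alt (lmulʳ y f) i (suc j) ≃ lmul y (Alt f i j)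
Alt-lmulʳ y f zero j = ≃-refl
Alt-lmulʳ y f (suc i) j = ≃-trans (⊖-cong ≃-refl (Alt-lmulʳ y f i (suc j)))
  (≡⇒≃ (sym (lmul-⊖ y (f (suc i) j) (Alt f i (suc j)))))

Alt-diag : ∀ f i j → Alt (diag f) (suc i) (suc j) ≃ Alt f i j
Alt-diag f zero j = ≡⇒≃ (++-identityʳ _)
Alt-diag f (suc i) j = ⊖-cong ≃-refl (Alt-diag f i (suc j))

Seq : Set
Seq = ℕ → Letter

tail : Seq → Seq
tail S k = S (suc k)

prefix : ℕ → Seq → Word
prefix zero S = []
prefix (suc n) S = S 0 ∷ prefix n (tail S)

prefix-suc : ∀ n S → prefix (suc n) S ≡ prefix n S ++ S n ∷ []
prefix-suc zero S = refl
prefix-suc (suc n) S = cong (S 0 ∷_) (prefix-suc n (tail S))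

Reversed : ℕ → Seq → Seq → Set
Reversed n R Y = ∀ k l → suc (k + l) ≡ n → R k ≡ Y l

reversed-tailˡ : ∀ {n R Y} → Reversed (suc n) R Y → Reversed n (tail R) Y
reversed-tailˡ rev k l e = rev (suc k) l (cong suc e)

reversed-tailʳ : ∀ {n R Y} → Reversed (suc n) R Y → Reversed n R (tail Y)
reversed-tailʳ rev k l e = rev k (suc l) (cong suc (trans (+-suc k l) e))

-- Padded with 0 beyond the end of the word; only prefixes of it are read.
fromWord : Word → Seq
fromWord [] k = 0
fromWord (x ∷ w) zero = x
fromWord (x ∷ w) (suc k) = fromWord w k

prefix-fromWord : ∀ C D {n} → length C ≡ n → prefix n (fromWord (C ++ D)) ≡ C
prefix-fromWord [] D refl = refl
prefix-fromWord (x ∷ C) D refl = cong (x ∷_) (prefix-fromWord C D refl)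

sum-prefix-fromWord : ∀ w → sum (prefix (length w) (fromWord w)) ≡ sum w
sum-prefix-fromWord w = cong sum
  (trans (cong (λ u → prefix (length w) (fromWord u)) (sym (++-identityʳ w))) (prefix-fromWord w [] refl))

fromWord-ʳ++ : ∀ w ys k → fromWord (w ʳ++ ys) (length w + k) ≡ fromWord ys k
fromWord-ʳ++ [] ys k = refl
fromWord-ʳ++ (x ∷ w) ys k =
  trans (cong (fromWord (w ʳ++ x ∷ ys)) (sym (+-suc (length w) k))) (fromWord-ʳ++ w (x ∷ ys) (suc k))

reversed-fromWord : ∀ w → Reversed (length w) (fromWord (reverse w)) (fromWord w)
reversed-fromWord w = reversed-ʳ++ w []
  where
  reversed-ʳ++ : ∀ w ys → Reversed (length w) (fromWord (w ʳ++ ys)) (fromWord w)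
  reversed-ʳ++ [] ys k l ()
  reversed-ʳ++ (x ∷ w) ys k zero e =
    trans (cong (fromWord (w ʳ++ x ∷ ys)) (trans (sym (+-identityʳ k)) (cong pred e)))
          (trans (cong (fromWord (w ʳ++ x ∷ ys)) (sym (+-identityʳ (length w)))) (fromWord-ʳ++ w (x ∷ ys) 0))
  reversed-ʳ++ (x ∷ w) ys k (suc l) e = reversed-ʳ++ w (x ∷ ys) k l (trans (sym (+-suc k l)) (cong pred e))

-- The alternating sums of ◇- and ◇ˡ-products of a reversed suffix and a prefix

◇-grid ◇ˡ-grid : Seq → Seq → Grid
◇-grid R Y a b = ◇w (prefix a R) (prefix b Y)
◇ˡ-grid R Y a b = prefix a R ◇ˡ prefix b Y

headSum : Seq → Seq → ℕ
headSum R Y = suc (R 0) + suc (Y 0)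

Alt-◇-expand : ∀ R Y n → Alt (◇-grid R Y) (suc n) 0 ≃
  (lmul (R 0) (Alt (◇-grid (tail R) Y) n 0) ⊕ neg (lmul (Y 0) (Alt (◇-grid R (tail Y)) n 0)))
  ⊖ s (headSum R Y) (Alt (diag (◇-grid (tail R) (tail Y))) (suc n) 0)
Alt-◇-expand R Y n = begin
  Alt (◇-grid R Y) (suc n) 0                                 ≈⟨ Alt-cong-off-origin {◇-grid R Y} recursion₊ recursion₀ n 0 ⟩
  Alt ((L ⊕ᴳ M) ⊖ᴳ sᴳ k D) (suc n) 0                          ≈⟨ Alt-⊖ᴳ (L ⊕ᴳ M) (sᴳ k D) (suc n) 0 ⟩
  Alt (L ⊕ᴳ M) (suc n) 0 ⊖ Alt (sᴳ k D) (suc n) 0             ≈⟨ ⊖-cong (Alt-⊕ᴳ L M (suc n) 0) (Alt-sᴳ k D (suc n) 0) ⟩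
  (Alt L (suc n) 0 ⊕ Alt M (suc n) 0) ⊖ s k (Alt D (suc n) 0)
    ≈⟨ ⊖-cong (⊕-cong (Alt-lmulˡ (R 0) (◇-grid (tail R) Y) n 0) (neg-cong (Alt-lmulʳ (Y 0) (◇-grid R (tail Y)) n 0))) ≃-refl ⟩
  (lmul (R 0) (Alt (◇-grid (tail R) Y) n 0) ⊕ neg (lmul (Y 0) (Alt (◇-grid R (tail Y)) n 0)))
    ⊖ s k (Alt D (suc n) 0)                                   ∎
  where
  open ≃-Reasoning
  k = headSum R Y
  L = lmulˡ (R 0) (◇-grid (tail R) Y)
  M = lmulʳ (Y 0) (◇-grid R (tail Y))
  D = diag (◇-grid (tail R) (tail Y))
  recursion₊ : ∀ a b → ◇-grid R Y (suc a) b ≃ ((L ⊕ᴳ M) ⊖ᴳ sᴳ k D) (suc a) b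
  recursion₊ a zero = ≡⇒≃ (sym (trans (++-identityʳ _) (trans (++-identityʳ _) (lmul-◇w-[] (R 0) (prefix a (tail R))))))
  recursion₊ a (suc b) = ≃-refl
  recursion₀ : ∀ b → ◇-grid R Y 0 (suc b) ≃ ((L ⊕ᴳ M) ⊖ᴳ sᴳ k D) 0 (suc b)
  recursion₀ b = ≡⇒≃ (sym (++-identityʳ _))

Alt-◇ˡ-expand : ∀ R Y n → Alt (◇ˡ-grid R Y) (suc n) 0 ≃
  lmul (R 0) (Alt (◇-grid (tail R) Y) n 0) ⊖ s (headSum R Y) (Alt (diag (◇ˡ-grid (tail R) (tail Y))) (suc n) 0)
Alt-◇ˡ-expand R Y n = begin
  Alt (◇ˡ-grid R Y) (suc n) 0                    ≈⟨ Alt-cong-off-origin {◇ˡ-grid R Y} recursion₊ (λ _ → ≃-refl) n 0 ⟩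
  Alt (L ⊖ᴳ sᴳ k D) (suc n) 0                    ≈⟨ Alt-⊖ᴳ L (sᴳ k D) (suc n) 0 ⟩
  Alt L (suc n) 0 ⊖ Alt (sᴳ k D) (suc n) 0       ≈⟨ ⊖-cong (Alt-lmulˡ (R 0) (◇-grid (tail R) Y) n 0) (Alt-sᴳ k D (suc n) 0) ⟩
  lmul (R 0) (Alt (◇-grid (tail R) Y) n 0) ⊖ s k (Alt D (suc n) 0) ∎
  where
  open ≃-Reasoning
  k = headSum R Y
  L = lmulˡ (R 0) (◇-grid (tail R) Y)
  D = diag (◇ˡ-grid (tail R) (tail Y))
  recursion₊ : ∀ a b → ◇ˡ-grid R Y (suc a) b ≃ (L ⊖ᴳ sᴳ k D) (suc a) b
  recursion₊ a zero = ≡⇒≃ (sym (trans (++-identityʳ _) (lmul-◇w-[] (R 0) (prefix a (tail R)))))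
  recursion₊ a (suc b) = ≃-refl

Alt-◇-vanishes : ∀ n R Y → Reversed (suc n) R Y → Alt (◇-grid R Y) (suc n) 0 ≃ []
Alt-◇-vanishes zero R Y rev = subst (λ y → x[ R 0 ] ⊖ x[ y ] ≃ []) (rev 0 0 refl) (⊖-self x[ R 0 ])
Alt-◇-vanishes (suc n) R Y rev = ≃-trans (Alt-◇-expand R Y (suc n))
  (⊖-cong (⊕-cong (lmul-cong (R 0) (Alt-◇-vanishes n (tail R) Y (reversed-tailˡ rev)))
                  (neg-cong (lmul-cong (Y 0) (Alt-◇-vanishes n R (tail Y) (reversed-tailʳ rev)))))
          (s-diag n (reversed-tailˡ (reversed-tailʳ rev))))
  where
  s-diag : ∀ m → Reversed m (tail R) (tail Y) →
           s (headSum R Y) (Alt (diag (◇-grid (tail R) (tail Y))) (suc (suc m)) 0) ≃ []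
  s-diag zero _ = ≃-refl
  s-diag (suc m) rev′ = s-cong (headSum R Y)
    (neg-cong (≃-trans (Alt-diag (◇-grid (tail R) (tail Y)) (suc m) 0) (Alt-◇-vanishes m (tail R) (tail Y) rev′)))

even : ℕ → Bool
even zero = true
even (suc zero) = false
even (suc (suc n)) = even n

whenEven : ℕ → Poly → Poly
whenEven n p = if even n then p else []

s-whenEven : ∀ k n a → s k (whenEven n x[ a ]) ≡ whenEven n x[ a + k ]
s-whenEven k n a with even n
... | true  = refl
... | false = refl

neg^-whenEven : ∀ n p → neg^ n (whenEven n p) ≃ whenEven n p
neg^-whenEven zero p = ≃-refl
neg^-whenEven (suc zero) p = ≃-refl
neg^-whenEven (suc (suc n)) p = ≃-trans (neg-involutive _) (neg^-whenEven n p)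

weight-step : ∀ m R Y → Reversed (3 + m) R Y →
  m + sum (prefix (suc m) (tail Y)) + headSum R Y ≡ 2 + m + sum (prefix (3 + m) Y)
weight-step m R Y rev = begin
  m + inner + (suc (R 0) + suc (Y 0))        ≡⟨ arith m inner (Y 0) (R 0) ⟩
  2 + m + (Y 0 + (inner + R 0))              ≡⟨ cong (λ r → 2 + m + (Y 0 + (inner + r))) (rev 0 (2 + m) refl) ⟩
  2 + m + (Y 0 + (inner + Y (2 + m)))        ≡⟨ cong (λ t → 2 + m + (Y 0 + t))
                                               (trans (cong (inner +_) (sym (+-identityʳ (Y (2 + m)))))
                                                      (sym (sum-++ (prefix (suc m) (tail Y)) (Y (2 + m) ∷ [])))) ⟩
  2 + m + (Y 0 + sum (prefix (suc m) (tail Y) ++ Y (2 + m) ∷ []))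
                                             ≡⟨ cong (λ u → 2 + m + sum (Y 0 ∷ u)) (prefix-suc (suc m) (tail Y)) ⟨
  2 + m + sum (prefix (3 + m) Y)             ∎
  where
  open ≡-Reasoning
  inner = sum (prefix (suc m) (tail Y))
  arith : ∀ m t y r → m + t + (suc r + suc y) ≡ 2 + m + (y + (t + r))
  arith = solve-∀

Alt-◇ˡ-reversed : ∀ n R Y → Reversed (suc n) R Y →
  Alt (◇ˡ-grid R Y) (suc n) 0 ≃ whenEven n x[ n + sum (prefix (suc n) Y) ]
Alt-◇ˡ-reversed zero R Y rev =
  ≡⇒≃ (trans (++-identityʳ _) (cong x[_] (trans (rev 0 0 refl) (sym (+-identityʳ (Y 0))))))
Alt-◇ˡ-reversed (suc zero) R Y rev =
  ≃-trans (Alt-◇ˡ-expand R Y 1) (⊖-cong (lmul-cong (R 0) (Alt-◇-vanishes 0 (tail R) Y (reversed-tailˡ rev))) ≃-refl)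
Alt-◇ˡ-reversed (suc (suc m)) R Y rev = begin
  Alt (◇ˡ-grid R Y) (3 + m) 0
    ≈⟨ Alt-◇ˡ-expand R Y (2 + m) ⟩
  lmul (R 0) (Alt (◇-grid (tail R) Y) (2 + m) 0) ⊖ s k (Alt (diag (◇ˡ-grid (tail R) (tail Y))) (3 + m) 0)
    ≈⟨ ⊖-cong (lmul-cong (R 0) (Alt-◇-vanishes (suc m) (tail R) Y (reversed-tailˡ rev)))
              (s-cong k (neg-cong (Alt-diag (◇ˡ-grid (tail R) (tail Y)) (suc m) 0))) ⟩
  neg (s k (neg (Alt (◇ˡ-grid (tail R) (tail Y)) (suc m) 0)))
    ≈⟨ neg-cong (s-cong k (neg-cong (Alt-◇ˡ-reversed m (tail R) (tail Y) (reversed-tailˡ (reversed-tailʳ rev))))) ⟩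
  neg (s k (neg (whenEven m x[ m + sum (prefix (suc m) (tail Y)) ])))
    ≈⟨ neg-cong (s-neg k (whenEven m x[ m + sum (prefix (suc m) (tail Y)) ])) ⟩
  neg (neg (s k (whenEven m x[ m + sum (prefix (suc m) (tail Y)) ])))
    ≈⟨ neg-involutive _ ⟩
  s k (whenEven m x[ m + sum (prefix (suc m) (tail Y)) ])
    ≡⟨ s-whenEven k m _ ⟩
  whenEven m x[ m + sum (prefix (suc m) (tail Y)) + k ]
    ≡⟨ cong (λ a → whenEven m x[ a ]) (weight-step m R Y rev) ⟩
  whenEven m x[ 2 + m + sum (prefix (3 + m) Y) ] ∎
  where
  open ≃-Reasoning
  k = headSum R Y

-- From the cyclic sum to the alternating sum

rotation : Word → ℕ → ℚ × Word
rotation w i = (1ℚ , drop i w ++ take i w)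

rotation-++ : ∀ A C → rotation (A ++ C) (length A) ≡ (1ℚ , C ++ A)
rotation-++ A C = cong₂ (λ u v → (1ℚ , u ++ v)) (drop-++ A) (take-++ A)
  where
  drop-++ : ∀ A → drop (length A) (A ++ C) ≡ C
  drop-++ [] = refl
  drop-++ (x ∷ A) = drop-++ A
  take-++ : ∀ A → take (length A) (A ++ C) ≡ A
  take-++ [] = refl
  take-++ (x ∷ A) = cong (x ∷_) (take-++ A)

applyUpTo-cong : ∀ {A : Set} {f g : ℕ → A} → f ≗ g → ∀ n → applyUpTo f n ≡ applyUpTo g n
applyUpTo-cong f≗g zero = refl
applyUpTo-cong f≗g (suc n) = cong₂ _∷_ (f≗g 0) (applyUpTo-cong (λ k → f≗g (suc k)) n)

rotations-∼ : ∀ w B A j → A ++ B ≡ w → j ≡ length A →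
  applyUpTo (λ k → rotation w (j + k)) (length B)
    ∼ neg^ (suc (length B)) (Alt (◇ˡ-grid (fromWord (reverse w)) (fromWord w)) (length B) j)
rotations-∼ w [] A j _ _ = ∼-refl
rotations-∼ .(A ++ x ∷ B) (x ∷ B) A .(length A) refl refl = begin
  (rotation w (length A + 0) ∷ []) ⊕ applyUpTo (λ k → rotation w (length A + suc k)) b
    ≈⟨ ∼-⊕ first rest ⟩
  neg^ b (G (suc b) (length A)) ⊕ neg^ (suc b) (Alt G b (suc (length A)))
    ≡⟨ neg^-⊖ b _ _ ⟨
  neg^ b (Alt G (suc b) (length A))
    ≈⟨ ≃⇒∼ (neg-involutive _) ⟨
  neg^ (suc (suc b)) (Alt G (suc b) (length A)) ∎
  where
  open ∼-Reasoning
  w = A ++ x ∷ B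
  b = length B
  G = ◇ˡ-grid (fromWord (reverse w)) (fromWord w)
  prefix-reverse : prefix (suc b) (fromWord (reverse w)) ≡ B ʳ++ x ∷ []
  prefix-reverse =
    trans (cong (λ u → prefix (suc b) (fromWord u)) (reverse-++ A (x ∷ B)))
          (prefix-fromWord (B ʳ++ x ∷ []) (reverse A) (trans (length-ʳ++ B) (+-comm b 1)))
  first : rotation w (length A + 0) ∷ [] ∼ neg^ b (G (suc b) (length A))
  first = begin
    rotation w (length A + 0) ∷ []   ≡⟨ cong (λ i → rotation w i ∷ []) (+-identityʳ (length A)) ⟩
    rotation w (length A) ∷ []       ≡⟨ cong (_∷ []) (rotation-++ A (x ∷ B)) ⟩
    mono (x ∷ B ++ A)                ≈⟨ ≃⇒∼ (◇ˡ-single x (B ++ A)) ⟨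
    (x ∷ []) ◇ˡ (B ++ A)             ≈⟨ ◇ˡ-transfer B x [] A ⟩
    neg^ b ((B ʳ++ x ∷ []) ◇ˡ A)     ≡⟨ cong₂ (λ u v → neg^ b (u ◇ˡ v)) prefix-reverse (prefix-fromWord A (x ∷ B) refl) ⟨
    neg^ b (G (suc b) (length A))    ∎
  rest : applyUpTo (λ k → rotation w (length A + suc k)) b ∼ neg^ (suc b) (Alt G b (suc (length A)))
  rest = subst (_∼ neg^ (suc b) (Alt G b (suc (length A))))
    (applyUpTo-cong (λ k → cong (rotation w) (sym (+-suc (length A) k))) b)
    (rotations-∼ w B (A ++ x ∷ []) (suc (length A)) (++-assoc A (x ∷ []) B)
      (sym (trans (length-++ A) (+-comm (length A) 1))))

odd-suc : ∀ n → (suc n % 2 ≡ᵇ 1) ≡ even n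
odd-suc zero = refl
odd-suc (suc zero) = refl
odd-suc (suc (suc n)) = odd-suc n

sum-positives : ∀ ls → All NonZero ls → sum ls ≡ length ls + sum (map pred ls)
sum-positives [] [] = refl
sum-positives (l ∷ ls) (l≢0 ∷ ls≢0) =
  trans (cong₂ _+_ (sym (suc-pred l {{l≢0}})) (sum-positives ls ls≢0))
        (arith (pred l) (length ls) (sum (map pred ls)))
  where
  arith : ∀ p n t → suc p + (n + t) ≡ suc (n + (p + t))
  arith = solve-∀

proposition2p1 : (ls : List ℕ) → length ls ≥ 1 → All NonZero ls →
    cyclicSum ls ≡ cyclicRHS ls mod◇
proposition2p1 [] () _
proposition2p1 (l ∷ ls) _ positive = _∼_.proof (begin
  cyclicSum (l ∷ ls)                          ≡⟨ map-upTo (rotation w) (length (l ∷ ls)) ⟩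
  applyUpTo (rotation w) (length (l ∷ ls))    ≡⟨ cong (applyUpTo (rotation w)) (length-map pred (l ∷ ls)) ⟨
  applyUpTo (rotation w) (suc n)              ≈⟨ rotations-∼ w w [] 0 refl refl ⟩
  neg^ (suc (suc n)) (Alt G (suc n) 0)        ≈⟨ ≃⇒∼ (neg-involutive _) ⟩
  neg^ n (Alt G (suc n) 0)                    ≈⟨ ≃⇒∼ (neg^-cong n (Alt-◇ˡ-reversed n R Y (reversed-fromWord w))) ⟩
  neg^ n (whenEven n x[ weight ])             ≈⟨ ≃⇒∼ (neg^-whenEven n _) ⟩
  whenEven n x[ weight ]                      ≡⟨ cong₂ (λ e a → if e then x[ a ] else []) parity total ⟩
  cyclicRHS (l ∷ ls)                          ∎)
  where
  open ∼-Reasoning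
  w = wordOf (l ∷ ls)
  n = length (wordOf ls)
  R = fromWord (reverse w)
  Y = fromWord w
  G = ◇ˡ-grid R Y
  weight = n + sum (prefix (suc n) Y)
  parity : even n ≡ (length (l ∷ ls) % 2 ≡ᵇ 1)
  parity = sym (trans (cong (λ m → suc m % 2 ≡ᵇ 1) (sym (length-map pred ls))) (odd-suc n))
  total : weight ≡ pred (sum (l ∷ ls))
  total = sym (trans (cong pred (sum-positives (l ∷ ls) positive))
    (cong₂ _+_ (sym (length-map pred ls)) (sym (sum-prefix-fromWord w))))
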